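{- Let $A$ be a set equipped with a ternary operation $p\colon A^3\to A$ and two constants $0,1\in A$ such that for all $a,b,c,b_1,b_2,b_3\in A$: (C1) $p(0,a,1)=a$; (C2) $p(a,b,a)=a$; (C3) $p(a,p(b_1,b_2,b_3),c)=p(p(a,b_1,c),b_2,p(a,b_3,c))$; (C4) $p(a,0,b)=a=p(b,1,a)$. Define $\bar{a}=p(1,a,0)$, $a\wedge b=p(0,a,b)$ and $a\vee b=p(a,b,1)$. Then for all $a,b,c\in A$: $\bar{1}=0$ and $\bar{0}=1$; $\bar{\bar{a}}=a$; $p(c,b,a)=p(a,\bar{b},c)$; $\overline{p(a,b,c)}=p(\bar{a},b,\bar{c})$; $\overline{p(a,b,c)}=p(\bar{c},\bar{b},\bar{a})$; $\overline{a\wedge b}=\bar{b}\vee\bar{a}$ and $\overline{a\vee b}=\bar{b}\wedge\bar{a}$; $(A,\wedge,1)$ is a monoid; $(A,\vee,0)$ is a monoid; $a\wedge 0=0=0\wedge a$; $a\vee 1=1=1\vee a$. -}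

module Defs where

open import Level using (Level)
open import Relation.Binary.PropositionalEquality using (_≡_)
open import Data.Product using (_×_)

record Cnf {a : Level} (A : Set a) : Set a where
  field
    p   : A → A → A → A
    𝟘   : A
    𝟙   : A
    C1  : ∀ x → p 𝟘 x 𝟙 ≡ x
    C2  : ∀ x y → p x y x ≡ x
    C3  : ∀ x b₁ b₂ b₃ z → p x (p b₁ b₂ b₃) z ≡ p (p x b₁ z) b₂ (p x b₃ z)
    C4  : ∀ x y → (p x 𝟘 y ≡ x) × (x ≡ p y 𝟙 x)

  ‾_ : A → A
  ‾ x = p 𝟙 x 𝟘

  _∧_ : A → A → A
  x ∧ y = p 𝟘 x y

  _∨_ : A → A → A
  x ∨ y = p x y 𝟙

{-# OPTIONS --safe #-}
module Submission where

open import Defs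
open import Level using (Level)
open import Data.Product using (_×_; _,_; proj₁; proj₂)
open import Relation.Binary.PropositionalEquality
  using (_≡_; sym; cong; cong₂; isEquivalence; module ≡-Reasoning)
open import Algebra.Structures using (IsMonoid)

-- Read p x b y as "if b then y else x": 𝟘 and 𝟙 select, negation is p 𝟙 _ 𝟘, and
-- (C3) distributes a selection over a nested one. Every identity below is one
-- application of (C3) followed by collapsing the selections on 𝟘 and 𝟙.

module CnfProperties {ℓ : Level} {A : Set ℓ} (C : Cnf A) where
  open Cnf C
  open ≡-Reasoning

  p-𝟘 : ∀ x y → p x 𝟘 y ≡ x
  p-𝟘 x y = proj₁ (C4 x y)

  p-𝟙 : ∀ x y → p x 𝟙 y ≡ y
  p-𝟙 x y = sym (proj₂ (C4 y x))

  ‾𝟙≡𝟘 : ‾ 𝟙 ≡ 𝟘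
  ‾𝟙≡𝟘 = p-𝟙 𝟙 𝟘

  ‾𝟘≡𝟙 : ‾ 𝟘 ≡ 𝟙
  ‾𝟘≡𝟙 = p-𝟘 𝟙 𝟘

  ‾-involutive : ∀ a → ‾ (‾ a) ≡ a
  ‾-involutive a = begin
    p 𝟙 (p 𝟙 a 𝟘) 𝟘          ≡⟨ C3 𝟙 𝟙 a 𝟘 𝟘 ⟩
    p (‾ 𝟙) a (‾ 𝟘)          ≡⟨ cong₂ (λ u v → p u a v) ‾𝟙≡𝟘 ‾𝟘≡𝟙 ⟩
    p 𝟘 a 𝟙                  ≡⟨ C1 a ⟩
    a                        ∎

  p-swap : ∀ a b c → p c b a ≡ p a (‾ b) c
  p-swap a b c = sym (begin
    p a (p 𝟙 b 𝟘) c          ≡⟨ C3 a 𝟙 b 𝟘 c ⟩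
    p (p a 𝟙 c) b (p a 𝟘 c)  ≡⟨ cong₂ (λ u v → p u b v) (p-𝟙 a c) (p-𝟘 a c) ⟩
    p c b a                  ∎)

  ‾-p : ∀ a b c → ‾ (p a b c) ≡ p (‾ a) b (‾ c)
  ‾-p a b c = C3 𝟙 a b c 𝟘

  ‾-p-reverse : ∀ a b c → ‾ (p a b c) ≡ p (‾ c) (‾ b) (‾ a)
  ‾-p-reverse a b c = begin
    ‾ (p a b c)              ≡⟨ ‾-p a b c ⟩
    p (‾ a) b (‾ c)          ≡⟨ p-swap (‾ c) b (‾ a) ⟩
    p (‾ c) (‾ b) (‾ a)      ∎

  ‾-∧ : ∀ a b → ‾ (a ∧ b) ≡ (‾ b) ∨ (‾ a)
  ‾-∧ a b = begin
    ‾ (p 𝟘 a b)              ≡⟨ ‾-p-reverse 𝟘 a b ⟩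
    p (‾ b) (‾ a) (‾ 𝟘)      ≡⟨ cong (p (‾ b) (‾ a)) ‾𝟘≡𝟙 ⟩
    (‾ b) ∨ (‾ a)            ∎

  ‾-∨ : ∀ a b → ‾ (a ∨ b) ≡ (‾ b) ∧ (‾ a)
  ‾-∨ a b = begin
    ‾ (p a b 𝟙)              ≡⟨ ‾-p-reverse a b 𝟙 ⟩
    p (‾ 𝟙) (‾ b) (‾ a)      ≡⟨ cong (λ u → p u (‾ b) (‾ a)) ‾𝟙≡𝟘 ⟩
    (‾ b) ∧ (‾ a)            ∎

  ∧-assoc : ∀ a b c → (a ∧ b) ∧ c ≡ a ∧ (b ∧ c)
  ∧-assoc a b c = begin
    p 𝟘 (p 𝟘 a b) c          ≡⟨ C3 𝟘 𝟘 a b c ⟩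
    p (p 𝟘 𝟘 c) a (b ∧ c)    ≡⟨ cong (λ u → p u a (b ∧ c)) (p-𝟘 𝟘 c) ⟩
    a ∧ (b ∧ c)              ∎

  ∨-assoc : ∀ a b c → (a ∨ b) ∨ c ≡ a ∨ (b ∨ c)
  ∨-assoc a b c = sym (begin
    p a (p b c 𝟙) 𝟙          ≡⟨ C3 a b c 𝟙 𝟙 ⟩
    p (a ∨ b) c (p a 𝟙 𝟙)    ≡⟨ cong (p (a ∨ b) c) (p-𝟙 a 𝟙) ⟩
    (a ∨ b) ∨ c              ∎)

  ∧-isMonoid : IsMonoid _≡_ _∧_ 𝟙
  ∧-isMonoid = record
    { isSemigroup = record
      { isMagma = record { isEquivalence = isEquivalence ; ∙-cong = cong₂ _∧_ }
      ; assoc   = ∧-assoc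
      }
    ; identity = p-𝟙 𝟘 , C1
    }

  ∨-isMonoid : IsMonoid _≡_ _∨_ 𝟘
  ∨-isMonoid = record
    { isSemigroup = record
      { isMagma = record { isEquivalence = isEquivalence ; ∙-cong = cong₂ _∨_ }
      ; assoc   = ∨-assoc
      }
    ; identity = C1 , (λ a → p-𝟘 a 𝟙)
    }

  ∧-zeroʳ : ∀ a → a ∧ 𝟘 ≡ 𝟘
  ∧-zeroʳ a = C2 𝟘 a

  ∧-zeroˡ : ∀ a → 𝟘 ∧ a ≡ 𝟘
  ∧-zeroˡ a = p-𝟘 𝟘 a

  ∨-zeroʳ : ∀ a → a ∨ 𝟙 ≡ 𝟙
  ∨-zeroʳ a = p-𝟙 a 𝟙

  ∨-zeroˡ : ∀ a → 𝟙 ∨ a ≡ 𝟙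
  ∨-zeroˡ a = C2 𝟙 a

lemma1 : ∀ {ℓ : Level} {A : Set ℓ} (C : Cnf A) → let open Cnf C in
    ((‾ 𝟙 ≡ 𝟘) × (‾ 𝟘 ≡ 𝟙))
    × (∀ a → ‾ (‾ a) ≡ a)
    × (∀ a b c → p c b a ≡ p a (‾ b) c)
    × (∀ a b c → ‾ (p a b c) ≡ p (‾ a) b (‾ c))
    × (∀ a b c → ‾ (p a b c) ≡ p (‾ c) (‾ b) (‾ a))
    × (∀ a b → (‾ (a ∧ b) ≡ (‾ b) ∨ (‾ a)) × (‾ (a ∨ b) ≡ (‾ b) ∧ (‾ a)))
    × IsMonoid _≡_ _∧_ 𝟙
    × IsMonoid _≡_ _∨_ 𝟘
    × (∀ a → (a ∧ 𝟘 ≡ 𝟘) × (𝟘 ≡ 𝟘 ∧ a))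
    × (∀ a → (a ∨ 𝟙 ≡ 𝟙) × (𝟙 ≡ 𝟙 ∨ a))
lemma1 C = let open CnfProperties C in
    (‾𝟙≡𝟘 , ‾𝟘≡𝟙)
  , ‾-involutive
  , p-swap
  , ‾-p
  , ‾-p-reverse
  , (λ a b → ‾-∧ a b , ‾-∨ a b)
  , ∧-isMonoid
  , ∨-isMonoid
  , (λ a → ∧-zeroʳ a , sym (∧-zeroˡ a))
  , (λ a → ∨-zeroʳ a , sym (∨-zeroˡ a))
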